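{- Let $\pi\in\mathfrak{B}_n$, with paths defined via the $r$-order $d$-types. In the grid $P_\pi$: (a) each $0_h^+$-path (resp. $1_h^+$-path) goes from the left boundary to the right boundary along horizontal grid lines, except that it takes a southeast (resp. northeast) step across a positive square when it encounters one; (b) each $0_v^+$-path (resp. $1_v^+$-path) goes from the top boundary to the bottom boundary along vertical grid lines, except that it takes a southeast (resp. southwest) step across a positive square when it encounters one; (c) each $0_h^-$-path (resp. $1_h^-$-path) goes from the left boundary to the right boundary along horizontal grid lines, except that it takes a southeast (resp. northeast) step across a negative square when it encounters one; (d) each $0_v^-$-path (resp. $1_v^-$-path) goes from the top boundary to the bottom boundary along vertical grid lines, except that it takes a southeast (resp. southwest) step across a negative square when it encounters one.
   Context: $\mathfrak{B}_n$ is the set of signed permutations $\pi=\pi_1\cdots\pi_n$ ($\pi_i\in\{\pm1,\dots,\pm n\}$, $|\pi_1|,\dots,|\pi_n|$ a permutation of $[n]$), $\pi_0=0$, inverse given by $\pi^{ -1}_{|\pi_i|}=\operatorname{sgn}(\pi_i)\,i$. The $r$-order on $\mathbb{Z}$ is $-1<_r-2<_r-3<_r\cdots<_r0<_r1<_r2<_r\cdots$; $\operatorname{des}_B(\pi)=|\{i\in\{0,\dots,n-1\}:\pi_i>_r\pi_{i+1}\}|$, $\operatorname{ides}_B(\pi)=\operatorname{des}_B(\pi^{ -1})$. The grid $P_\pi$ is an $n\times n$ array of squares (rows from top, columns from left); $\langle i,j\rangle$ is the square in row $i$, column $j$; $\langle i,|\pi_i|\rangle$ is a positive square if $\pi_i>0$,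 negative if $\pi_i<0$. Grid point $(i,j)$ ($1\le i,j\le n+1$) is the intersection of the $i$-th horizontal and $j$-th vertical grid lines. For $i,j\in[n+1]$, $\varphi_{(i,j)}(\pi)$ is the $\sigma\in\mathfrak{B}_{n+1}$ with $\sigma_i=j$, $\sigma_k=s(\pi_k)$ for $k<i$, $\sigma_k=s(\pi_{k-1})$ for $k>i$, where $s(x)=x$ if $|x|<j$, $s(x)=x+1$ if $x\ge j$, $s(x)=x-1$ if $x\le-j$; $\overline{\varphi}_{(i,j)}(\pi)$ is the same with $\sigma_i=-j$. $d^+(i,j)=(d_h^+(i,j),d_v^+(i,j))=\big(\operatorname{des}_B(\varphi_{(i,j)}(\pi))-\operatorname{des}_B(\pi),\ \operatorname{ides}_B(\varphi_{(i,j)}(\pi))-\operatorname{ides}_B(\pi)\big)$, and $d^-(i,j)=(d_h^-(i,j),d_v^-(i,j))$ is the same with $\overline{\varphi}_{(i,j)}$. Paths: for $p\in\{0,1\}$, the $p_h^+$-paths (resp. $p_h^-$-paths) are obtained by connecting grid points of $d_h^+$-type (resp. $d_h^-$-type) $p$ only along horizontal grid lines, and then connecting the resulting segments that do not span a full grid line by diagonal lines only if they touch the same filled square; the $q_v^\pm$-paths are obtained analogously using $d_v^\pm$-types and vertical grid lines. -}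

module Defs where

open import Data.Bool using (Bool; true; false; if_then_else_)
open import Data.Nat using (ℕ; zero; suc; _≤_; _<ᵇ_; _≡ᵇ_; _∸_)
open import Data.Integer using (ℤ; +_; -[1+_]; -_; _-_; ∣_∣; 0ℤ)
open import Data.List using (List; []; _∷_; map; upTo; length)
open import Data.List.Relation.Binary.Permutation.Propositional using (_↭_)
open import Data.Product using (_×_; _,_; Σ; ∃; proj₁; proj₂)
open import Data.Sum using (_⊎_)
open import Relation.Nullary using (¬_)
open import Relation.Binary.PropositionalEquality using (_≡_)
open import Relation.Binary.Construct.Closure.ReflexiveTransitive using (Star)
open import Relation.Binary.Construct.Closure.Symmetric using (SymClosure)
open import Function.Bundles using (_⇔_)

-- Signed permutations, written in one-line notation as lists π₁ ⋯ πₙ.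
-- w is in 𝔅ₙ iff |π₁|,…,|πₙ| is a permutation of [n] = 1,…,n.

IsSignedPerm : ℕ → List ℤ → Set
IsSignedPerm n w = map ∣_∣ w ↭ map suc (upTo n)

-- 1-based entry πᵢ (returns 0 outside 1 ≤ i ≤ length, in particular π₀ = 0).
entry : List ℤ → ℕ → ℤ
entry []       _             = 0ℤ
entry (x ∷ xs) zero          = 0ℤ
entry (x ∷ xs) (suc zero)    = x
entry (x ∷ xs) (suc (suc k)) = entry xs (suc k)

-- The r-order  -1 <r -2 <r -3 <r ⋯ <r 0 <r 1 <r 2 <r ⋯  (boolean test x <r y).

_<r_ : ℤ → ℤ → Bool
-[1+ a ] <r -[1+ b ] = a <ᵇ b
-[1+ a ] <r (+ b)    = true
(+ a)    <r -[1+ b ] = false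
(+ a)    <r (+ b)    = a <ᵇ b

descents : List ℤ → ℕ
descents []           = 0
descents (x ∷ [])     = 0
descents (x ∷ y ∷ ys) = (if y <r x then 1 else 0) Data.Nat.+ descents (y ∷ ys)

desB : List ℤ → ℕ
desB w = descents (0ℤ ∷ w)

-- Inverse: π⁻¹_{|πᵢ|} = sgn(πᵢ) i.

sgnTimes : ℤ → ℕ → ℤ
sgnTimes -[1+ _ ] m = - (+ m)
sgnTimes (+ _)    m = + m

-- position search: the value sgn(πᵢ)·i for the unique i with |πᵢ| = k
-- (m is the 1-based index of the head of the list)
posOf : ℕ → List ℤ → ℕ → ℤ
posOf k []       m = 0ℤ
posOf k (x ∷ xs) m = if ∣ x ∣ ≡ᵇ k then sgnTimes x m else posOf k xs (suc m)

invB : List ℤ → List ℤ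
invB w = map (λ k → posOf k w 1) (map suc (upTo (length w)))

idesB : List ℤ → ℕ
idesB w = desB (invB w)

shift : ℕ → ℤ → ℤ
shift j (+ a)    = if a <ᵇ j then + a else + suc a
shift j -[1+ a ] = if suc a <ᵇ j then -[1+ a ] else -[1+ suc a ]

-- insert a value so that it becomes the (k+1)-st entry
ins : ℕ → ℤ → List ℤ → List ℤ
ins zero    v xs       = v ∷ xs
ins (suc k) v []       = v ∷ []
ins (suc k) v (x ∷ xs) = x ∷ ins k v xs

data PM : Set where
  plus minus : PM

val : PM → ℕ → ℤ
val plus  j = + j
val minus j = - (+ j)

-- φ (plus) and φ̄ (minus): σᵢ = ±j, other entries shifted by s
φ : PM → ℕ → ℕ → List ℤ → List ℤ
φ pm i j w = ins (i ∸ 1) (val pm j) (map (shift j) w)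

data Dir : Set where
  horiz vert : Dir

stat : Dir → List ℤ → ℕ
stat horiz w = desB w
stat vert  w = idesB w

dtype : Dir → PM → List ℤ → ℕ → ℕ → ℤ
dtype d pm w i j = (+ stat d (φ pm i j w)) - (+ stat d w)

-- Grid P_π.  Grid point (i,j): i-th horizontal line, j-th vertical line.

GP : Set
GP = ℕ × ℕ

InGrid : ℕ → GP → Set
InGrid n (i , j) = 1 ≤ i × i ≤ suc n × 1 ≤ j × j ≤ suc n

Sq : PM → List ℤ → ℕ → ℕ → Set
Sq pm w i j = 1 ≤ j × entry w i ≡ val pm j


nextOn : Dir → GP → GP
nextOn horiz (i , j) = (i , suc j)
nextOn vert  (i , j) = (suc i , j)

prevOn : Dir → GP → GP
prevOn horiz (i , j) = (i , j ∸ 1)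
prevOn vert  (i , j) = (i ∸ 1 , j)

onLine : Dir → GP → ℕ → GP
onLine horiz (i , j) k = (i , k)
onLine vert  (i , j) k = (k , j)

StepRule : Dir → ℕ → PM → List ℤ → GP → GP → Set
-- 0_h: east, or southeast across a filled square ⟨i,j⟩
StepRule horiz zero    pm w (i , j) v =
  (Sq pm w i j → v ≡ (suc i , suc j)) × (¬ Sq pm w i j → v ≡ (i , suc j))
-- 1_h: east, or northeast across a filled square ⟨i-1,j⟩
StepRule horiz (suc _) pm w (i , j) v =
  (Sq pm w (i ∸ 1) j → v ≡ (i ∸ 1 , suc j)) × (¬ Sq pm w (i ∸ 1) j → v ≡ (i , suc j))
-- 0_v: south, or southeast across a filled square ⟨i,j⟩
StepRule vert  zero    pm w (i , j) v =
  (Sq pm w i j → v ≡ (suc i , suc j)) × (¬ Sq pm w i j → v ≡ (suc i , j))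
-- 1_v: south, or southwest across a filled square ⟨i,j-1⟩
StepRule vert  (suc _) pm w (i , j) v =
  (Sq pm w i (j ∸ 1) → v ≡ (suc i , j ∸ 1)) × (¬ Sq pm w i (j ∸ 1) → v ≡ (suc i , j))

StartOn : Dir → GP → Set
StartOn horiz (i , j) = j ≡ 1
StartOn vert  (i , j) = i ≡ 1

EndOn : ℕ → Dir → GP → Set
EndOn n horiz (i , j) = j ≡ suc n
EndOn n vert  (i , j) = i ≡ suc n

module Paths (n : ℕ) (w : List ℤ) (d : Dir) (pm : PM) (p : ℕ) where

  Vtx : GP → Set
  Vtx v = InGrid n v × dtype d pm w (proj₁ v) (proj₂ v) ≡ + p

  Endpoint : GP → Set
  Endpoint v = ¬ Vtx (nextOn d v) ⊎ ¬ Vtx (prevOn d v)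

  FullLine : GP → Set
  FullLine v = ∀ k → 1 ≤ k → k ≤ suc n → Vtx (onLine d v k)

  data Link : GP → GP → Set where
    line : ∀ {u} → Vtx u → Vtx (nextOn d u) → Link u (nextOn d u)
    diag : ∀ i j → Sq pm w i j →
           Vtx (i , j) → Vtx (suc i , suc j) →
           Endpoint (i , j) → Endpoint (suc i , suc j) →
           ¬ FullLine (i , j) → ¬ FullLine (suc i , suc j) →
           Link (i , j) (suc i , suc j)
    anti : ∀ i j → Sq pm w i j →
           Vtx (i , suc j) → Vtx (suc i , j) →
           Endpoint (i , suc j) → Endpoint (suc i , j) →
           ¬ FullLine (i , suc j) → ¬ FullLine (suc i , j) →
           Link (i , suc j) (suc i , j)

  -- u and v lie on the same p-path (connected component)
  Conn : GP → GP → Set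
  Conn = Star (SymClosure Link)

  DescribedPath : GP → (ℕ → GP) → Set
  DescribedPath v γ =
      StartOn d (γ 1)
    × EndOn n d (γ (suc n))
    × (∀ t → 1 ≤ t → t ≤ n → StepRule d p pm w (γ t) (γ (suc t)) × SymClosure Link (γ t) (γ (suc t)))
    × (∀ u → Conn v u ⇔ (Σ ℕ λ t → 1 ≤ t × t ≤ suc n × u ≡ γ t))

PathClaim : Dir → PM → Set
PathClaim d pm =
  ∀ n (w : List ℤ) → IsSignedPerm n w →
  ∀ p → p ≤ 1 →
  ∀ v → Paths.Vtx n w d pm p v →
  Σ (ℕ → GP) λ γ → Paths.DescribedPath n w d pm p v γ

{-# OPTIONS --safe #-}
-- Inserting ±j at position i changes des_B only through the entries π_{i-1}
-- and π_i next to the insertion point, so the d_h-type of a grid point (i , j)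
-- depends only on the rows i - 1 and i adjacent to its horizontal grid line.
-- Along that line the type is therefore constant except at the corners of a
-- filled square, where it is 0 at the top-left and bottom-right corners and 1
-- at the other two. Hence every point of type p has exactly one successor of
-- type p in the next column (east, or across a filled square: southeast for
-- p = 0, northeast for p = 1); this successor map is injective and its steps
-- are exactly the edges, so the p-paths are its orbits, which run from the left
-- to the right boundary.
-- Inversion transposes the grid: (φ_(i,j) π)⁻¹ = φ_(j,i) π⁻¹ and the filled
-- squares of π⁻¹ are those of π reflected in the diagonal, so the d_v-paths of
-- π are the transposed d_h-paths of π⁻¹.
module Submission where

open import Data.Bool using (Bool; true; false; if_then_else_; not)
open import Data.Bool.Properties using (T-≡)
open import Data.Integer using (ℤ; +_; -[1+_]; 0ℤ; _-_; _⊖_; ∣_∣)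
open import Data.Integer.Properties using (+-injective; _≟_; [+m]-[+n]≡m⊖n; ⊖-≥)
open import Data.List using (List; []; _∷_; map; length; upTo; applyUpTo)
open import Data.List.Membership.Propositional using (_∈_)
open import Data.List.Membership.Propositional.Properties using (∈-map⁺; ∈-map⁻; ∈-upTo⁺; ∈-upTo⁻)
open import Data.List.Properties using (length-map; length-upTo; length-applyUpTo; map-upTo; map-applyUpTo)
open import Data.List.Relation.Binary.Permutation.Propositional using (↭-sym; ↭⇒↭ₛ)
open import Data.List.Relation.Binary.Permutation.Propositional.Properties using (↭-length; ∈-resp-↭)
open import Data.List.Relation.Binary.Permutation.Setoid.Properties using (Unique-resp-↭)
open import Data.List.Relation.Unary.All as All using ()
open import Data.List.Relation.Unary.AllPairs using (_∷_)
open import Data.List.Relation.Unary.Any using (here; there)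
open import Data.List.Relation.Unary.Unique.Propositional using (Unique)
import Data.List.Relation.Unary.Unique.Propositional.Properties as Unique
open import Data.Maybe using (Maybe; just; nothing)
open import Data.Maybe.Properties using (just-injective)
open import Data.Nat using (ℕ; zero; suc; _+_; _∸_; _≤_; _<_; _<ᵇ_; _≡ᵇ_; z≤n; s≤s; _≤?_)
open import Data.Nat.Properties
  using ( suc-injective; ≡ᵇ⇒≡; ≡⇒≡ᵇ; <ᵇ⇒<; <⇒<ᵇ; <-cmp
        ; ≤-refl; ≤-trans; ≤-pred; n≤1+n; m≤n⇒m≤1+n; m≤n⇒m<n∨m≡n
        ; <-irrefl; <-trans; <-≤-trans; <⇒≤; <⇒≱; n<1+n
        ; +-assoc; +-identityʳ; +-suc; m≤m+n; m<m+n; m+n∸m≡n; m+n∸n≡m; n∸n≡0; +-∸-assoc )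
open import Data.Nat.Tactic.RingSolver using (solve-∀)
open import Data.Product using (_×_; _,_; Σ; ∃; proj₁; proj₂; swap)
open import Data.Sum as Sum using (_⊎_; inj₁; inj₂)
open import Function using (_∘_)
open import Function.Bundles using (Equivalence; _⇔_; mk⇔)
open import Relation.Binary using (tri<; tri≈; tri>)
open import Relation.Binary.Construct.Closure.ReflexiveTransitive using (ε; _◅_; _◅◅_; reverse; gmap)
open import Relation.Binary.Construct.Closure.Symmetric using (SymClosure; fwd; bwd; symmetric)
open import Relation.Binary.PropositionalEquality
  using (_≡_; _≢_; refl; sym; trans; cong; cong₂; subst; subst₂; setoid; module ≡-Reasoning)
open import Relation.Nullary using (¬_; Dec; yes; no; contradiction)
open import Relation.Nullary.Decidable using (_×-dec_)

open import Defs

open ≡-Reasoning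

-- Horizontal d-types

bit : Bool → ℕ
bit b = if b then 1 else 0

<⇒<ᵇ≡true : ∀ {m n} → m < n → (m <ᵇ n) ≡ true
<⇒<ᵇ≡true m<n = Equivalence.to T-≡ (<⇒<ᵇ m<n)

<ᵇ≡true⇒< : ∀ {m n} → (m <ᵇ n) ≡ true → m < n
<ᵇ≡true⇒< {m} {n} e = <ᵇ⇒< m n (Equivalence.from T-≡ e)

≤⇒>ᵇ≡false : ∀ {m n} → n ≤ m → (m <ᵇ n) ≡ false
≤⇒>ᵇ≡false {m} {n} n≤m with m <ᵇ n in e
... | true  = contradiction n≤m (<⇒≱ (<ᵇ≡true⇒< e))
... | false = refl

<ᵇ-irrefl : ∀ m → (m <ᵇ m) ≡ false
<ᵇ-irrefl m = ≤⇒>ᵇ≡false {m} ≤-refl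

<ᵇ-asym : ∀ m n → (m <ᵇ n) ≡ true → (n <ᵇ m) ≡ false
<ᵇ-asym m n e = ≤⇒>ᵇ≡false {n} (<⇒≤ (<ᵇ≡true⇒< {m} e))

<ᵇ-trans : ∀ m n o → (m <ᵇ n) ≡ true → (n <ᵇ o) ≡ true → (m <ᵇ o) ≡ true
<ᵇ-trans m n o e f = <⇒<ᵇ≡true (<-trans (<ᵇ≡true⇒< {m} {n} e) (<ᵇ≡true⇒< {n} {o} f))

≢⇒<ᵇ⊎>ᵇ : ∀ m n → m ≢ n → (m <ᵇ n) ≡ true ⊎ (n <ᵇ m) ≡ true
≢⇒<ᵇ⊎>ᵇ m n m≢n with <-cmp m n
... | tri< m<n _ _ = inj₁ (<⇒<ᵇ≡true m<n)
... | tri≈ _ m≡n _ = contradiction m≡n m≢n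
... | tri> _ _ n<m = inj₂ (<⇒<ᵇ≡true n<m)

<ᵇ-suc : ∀ m n → m ≢ n → (m <ᵇ suc n) ≡ (m <ᵇ n)
<ᵇ-suc m n m≢n with <-cmp m n
... | tri< m<n _ _ = trans (<⇒<ᵇ≡true (<-trans m<n (n<1+n n))) (sym (<⇒<ᵇ≡true m<n))
... | tri≈ _ m≡n _ = contradiction m≡n m≢n
... | tri> _ _ n<m = trans (≤⇒>ᵇ≡false {m} n<m) (sym (≤⇒>ᵇ≡false {m} (<⇒≤ n<m)))

<r-irrefl : ∀ x → (x <r x) ≡ false
<r-irrefl (+ a)    = <ᵇ-irrefl a
<r-irrefl -[1+ a ] = <ᵇ-irrefl a

<r-asym : ∀ x y → (x <r y) ≡ true → (y <r x) ≡ false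
<r-asym (+ a)    (+ b)    e = <ᵇ-asym a b e
<r-asym -[1+ a ] (+ b)    e = refl
<r-asym -[1+ a ] -[1+ b ] e = <ᵇ-asym a b e

<r-trans : ∀ x y z → (x <r y) ≡ true → (y <r z) ≡ true → (x <r z) ≡ true
<r-trans (+ a)    (+ b)    (+ c)    e f = <ᵇ-trans a b c e f
<r-trans -[1+ a ] _        (+ c)    e f = refl
<r-trans -[1+ a ] -[1+ b ] -[1+ c ] e f = <ᵇ-trans a b c e f

≢⇒<r⊎>r : ∀ x y → x ≢ y → (x <r y) ≡ true ⊎ (y <r x) ≡ true
≢⇒<r⊎>r (+ a)    (+ b)    x≢y = ≢⇒<ᵇ⊎>ᵇ a b (λ a≡b → x≢y (cong +_ a≡b))
≢⇒<r⊎>r (+ a)    -[1+ b ] x≢y = inj₂ refl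
≢⇒<r⊎>r -[1+ a ] (+ b)    x≢y = inj₁ refl
≢⇒<r⊎>r -[1+ a ] -[1+ b ] x≢y = ≢⇒<ᵇ⊎>ᵇ a b (λ a≡b → x≢y (cong -[1+_] a≡b))

val-<r-val-suc : ∀ pm k → (val pm (suc k) <r val pm (suc (suc k))) ≡ true
val-<r-val-suc plus  k = <⇒<ᵇ≡true (n<1+n (suc k))
val-<r-val-suc minus k = <⇒<ᵇ≡true (n<1+n k)

<r-val-suc : ∀ pm k x → x ≢ val pm (suc k) → (x <r val pm (suc (suc k))) ≡ (x <r val pm (suc k))
<r-val-suc plus  k (+ a)    x≢v = <ᵇ-suc a (suc k) (λ a≡k → x≢v (cong +_ a≡k))
<r-val-suc plus  k -[1+ a ] _   = refl
<r-val-suc minus k (+ a)    _   = refl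
<r-val-suc minus k -[1+ a ] x≢v = <ᵇ-suc a k (λ a≡k → x≢v (cong -[1+_] a≡k))

-- The change of des_B when v = ±j is inserted between the images under
-- shift j of neighbouring entries a and b (b = nothing: after the last entry).
-- Since shift j moves every entry that is not <r v above v, the new pair
-- (shift j a , v) is a descent exactly when ¬ a <r v.
descentGain : ℤ → Maybe ℤ → ℤ → ℕ
descentGain a nothing  v = bit (not (a <r v))
descentGain a (just b) v = bit (not (a <r v)) + bit (b <r v) ∸ bit (b <r a)

descentGain-after-equal : ∀ {a v} mb → a ≡ v → descentGain a mb v ≡ 1
descentGain-after-equal {v = v} nothing  refl rewrite <r-irrefl v = refl
descentGain-after-equal {v = v} (just b) refl rewrite <r-irrefl v = m+n∸n≡m 1 (bit (b <r v))

descentGain-before-equal : ∀ {a b v} → b ≡ v → a ≢ b → descentGain a (just b) v ≡ 0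
descentGain-before-equal {a} {v = v} refl a≢v rewrite <r-irrefl v with ≢⇒<r⊎>r a v a≢v
... | inj₁ a<v rewrite a<v | <r-asym a v a<v = refl
... | inj₂ v<a rewrite v<a | <r-asym v a v<a = refl

descentGain-after-pred : ∀ pm k {a} mb → a ≡ val pm (suc k) → mb ≢ just a →
                         descentGain a mb (val pm (suc (suc k))) ≡ 0
descentGain-after-pred pm k nothing  refl _ rewrite val-<r-val-suc pm k = refl
descentGain-after-pred pm k (just b) refl b≢v
  rewrite val-<r-val-suc pm k | <r-val-suc pm k b (λ b≡v → b≢v (cong just b≡v)) =
  n∸n≡0 (bit (b <r val pm (suc k)))

descentGain-before-pred : ∀ pm k {a b} → b ≡ val pm (suc k) → a ≢ b →
                          descentGain a (just b) (val pm (suc (suc k))) ≡ 1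
descentGain-before-pred pm k {a} refl a≢v
  rewrite <r-val-suc pm k a a≢v | val-<r-val-suc pm k with ≢⇒<r⊎>r a (val pm (suc k)) a≢v
... | inj₁ a<v rewrite a<v | <r-asym a (val pm (suc k)) a<v = refl
... | inj₂ v<a rewrite v<a | <r-asym (val pm (suc k)) a v<a = refl

descentGain-val-suc : ∀ pm k a mb → a ≢ val pm (suc k) → mb ≢ just (val pm (suc k)) →
                      descentGain a mb (val pm (suc k)) ≡ descentGain a mb (val pm (suc (suc k)))
descentGain-val-suc pm k a nothing  a≢v _ rewrite <r-val-suc pm k a a≢v = refl
descentGain-val-suc pm k a (just b) a≢v b≢v
  rewrite <r-val-suc pm k a a≢v | <r-val-suc pm k b (λ b≡v → b≢v (cong just b≡v)) = refl

shiftℕ : ℕ → ℕ → ℕ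
shiftℕ k a = if a <ᵇ k then a else suc a

shiftℕ-suc : ∀ k a → shiftℕ (suc k) (suc a) ≡ suc (shiftℕ k a)
shiftℕ-suc k a with a <ᵇ k
... | true  = refl
... | false = refl

shift-+ : ∀ k a → shift (suc k) (+ a) ≡ + shiftℕ (suc k) a
shift-+ k a with a <ᵇ suc k
... | true  = refl
... | false = refl

shift--[1+] : ∀ k a → shift (suc k) -[1+ a ] ≡ -[1+ shiftℕ k a ]
shift--[1+] k a with a <ᵇ k
... | true  = refl
... | false = refl

shiftℕ-<ᵇ : ∀ k a b → (shiftℕ k a <ᵇ shiftℕ k b) ≡ (a <ᵇ b)
shiftℕ-<ᵇ zero    a       b       = refl
shiftℕ-<ᵇ (suc k) zero    zero    = refl
shiftℕ-<ᵇ (suc k) zero    (suc b) rewrite shiftℕ-suc k b = refl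
shiftℕ-<ᵇ (suc k) (suc a) zero    = refl
shiftℕ-<ᵇ (suc k) (suc a) (suc b) rewrite shiftℕ-suc k a | shiftℕ-suc k b = shiftℕ-<ᵇ k a b

shiftℕ-<ᵇ-bound : ∀ k a → (shiftℕ k a <ᵇ k) ≡ (a <ᵇ k)
shiftℕ-<ᵇ-bound zero    a       = refl
shiftℕ-<ᵇ-bound (suc k) zero    = refl
shiftℕ-<ᵇ-bound (suc k) (suc a) rewrite shiftℕ-suc k a = shiftℕ-<ᵇ-bound k a

bound-<ᵇ-shiftℕ : ∀ k a → (k <ᵇ shiftℕ k a) ≡ not (a <ᵇ k)
bound-<ᵇ-shiftℕ zero    a       = refl
bound-<ᵇ-shiftℕ (suc k) zero    = refl
bound-<ᵇ-shiftℕ (suc k) (suc a) rewrite shiftℕ-suc k a = bound-<ᵇ-shiftℕ k a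

shift-<r : ∀ k x y → (shift (suc k) x <r shift (suc k) y) ≡ (x <r y)
shift-<r k (+ a)    (+ b)    rewrite shift-+ k a      | shift-+ k b      = shiftℕ-<ᵇ (suc k) a b
shift-<r k (+ a)    -[1+ b ] rewrite shift-+ k a      | shift--[1+] k b = refl
shift-<r k -[1+ a ] (+ b)    rewrite shift--[1+] k a | shift-+ k b      = refl
shift-<r k -[1+ a ] -[1+ b ] rewrite shift--[1+] k a | shift--[1+] k b = shiftℕ-<ᵇ k a b

shift-<r-val : ∀ pm k x → (shift (suc k) x <r val pm (suc k)) ≡ (x <r val pm (suc k))
shift-<r-val plus  k (+ a)    rewrite shift-+ k a      = shiftℕ-<ᵇ-bound (suc k) a
shift-<r-val plus  k -[1+ a ] rewrite shift--[1+] k a = refl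
shift-<r-val minus k (+ a)    rewrite shift-+ k a      = refl
shift-<r-val minus k -[1+ a ] rewrite shift--[1+] k a = shiftℕ-<ᵇ-bound k a

val-<r-shift : ∀ pm k x → (val pm (suc k) <r shift (suc k) x) ≡ not (x <r val pm (suc k))
val-<r-shift plus  k (+ a)    rewrite shift-+ k a      = bound-<ᵇ-shiftℕ (suc k) a
val-<r-shift plus  k -[1+ a ] rewrite shift--[1+] k a = refl
val-<r-shift minus k (+ a)    rewrite shift-+ k a      = refl
val-<r-shift minus k -[1+ a ] rewrite shift--[1+] k a = bound-<ᵇ-shiftℕ k a

descents-map : ∀ (g : ℤ → ℤ) → (∀ x y → (g x <r g y) ≡ (x <r y)) →
               ∀ xs → descents (map g xs) ≡ descents xs
descents-map g g-<r []           = refl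
descents-map g g-<r (x ∷ [])     = refl
descents-map g g-<r (x ∷ y ∷ ys) = cong₂ _+_ (cong bit (g-<r y x)) (descents-map g g-<r (y ∷ ys))

entry-map : ∀ (g : ℤ → ℤ) → g 0ℤ ≡ 0ℤ → ∀ xs i → entry (map g xs) i ≡ g (entry xs i)
entry-map g g0 []       i             = sym g0
entry-map g g0 (x ∷ xs) zero          = sym g0
entry-map g g0 (x ∷ xs) (suc zero)    = refl
entry-map g g0 (x ∷ xs) (suc (suc i)) = entry-map g g0 xs (suc i)

descents-ins : ∀ v x ys k → k < length ys →
  let a = entry (x ∷ ys) (suc k); b = entry ys (suc k) in
  descents (x ∷ ins k v ys) + bit (b <r a) ≡ descents (x ∷ ys) + (bit (v <r a) + bit (b <r v))
descents-ins v x (y ∷ ys) zero    _ =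
  rearrange (bit (v <r x)) (bit (y <r v)) (bit (y <r x)) (descents (y ∷ ys))
  where
  rearrange : ∀ a b c d → a + (b + d) + c ≡ c + d + (a + b)
  rearrange = solve-∀
descents-ins v x (y ∷ ys) (suc k) (s≤s k<n) = begin
  bit (y <r x) + descents (y ∷ ins k v ys) + B    ≡⟨ +-assoc (bit (y <r x)) _ B ⟩
  bit (y <r x) + (descents (y ∷ ins k v ys) + B)  ≡⟨ cong (λ d → bit (y <r x) + d) IH ⟩
  bit (y <r x) + (descents (y ∷ ys) + AC)         ≡⟨ +-assoc (bit (y <r x)) _ AC ⟨
  bit (y <r x) + descents (y ∷ ys) + AC           ∎
  where
  B  = bit (entry ys (suc k) <r entry (y ∷ ys) (suc k))
  AC = bit (v <r entry (y ∷ ys) (suc k)) + bit (entry ys (suc k) <r v)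
  IH = descents-ins v y ys k k<n

descents-ins-last : ∀ v x ys →
  descents (x ∷ ins (length ys) v ys) ≡ descents (x ∷ ys) + bit (v <r entry (x ∷ ys) (suc (length ys)))
descents-ins-last v x []       = +-identityʳ (bit (v <r x))
descents-ins-last v x (y ∷ ys) = begin
  bit (y <r x) + descents (y ∷ ins (length ys) v ys)  ≡⟨ cong (λ d → bit (y <r x) + d) IH ⟩
  bit (y <r x) + (descents (y ∷ ys) + A)              ≡⟨ +-assoc (bit (y <r x)) _ A ⟨
  bit (y <r x) + descents (y ∷ ys) + A                ∎
  where
  A  = bit (v <r entry (y ∷ ys) (suc (length ys)))
  IH = descents-ins-last v y ys

entry-0∷ : ∀ w i → entry (0ℤ ∷ w) (suc i) ≡ entry w i
entry-0∷ []      zero    = refl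
entry-0∷ (_ ∷ _) zero    = refl
entry-0∷ w       (suc i) = refl

entry-zero : ∀ w → entry w 0 ≡ 0ℤ
entry-zero []      = refl
entry-zero (_ ∷ _) = refl

-- Grid line i lies between rows i ∸ 1 and i; row n + 1 does not exist.
rowBelow : ℕ → List ℤ → ℕ → Maybe ℤ
rowBelow n w i with i ≤? n
... | yes _ = just (entry w i)
... | no  _ = nothing

rowBelow-≤ : ∀ n w i → i ≤ n → rowBelow n w i ≡ just (entry w i)
rowBelow-≤ n w i i≤n with i ≤? n
... | yes _   = refl
... | no  i≰n = contradiction i≤n i≰n

rowBelow-> : ∀ n w i → n < i → rowBelow n w i ≡ nothing
rowBelow-> n w i n<i with i ≤? n
... | yes i≤n = contradiction i≤n (<⇒≱ n<i)
... | no  _   = refl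

dtype-≡ : ∀ d pm w i j g → stat d (φ pm i j w) ≡ stat d w + g → dtype d pm w i j ≡ + g
dtype-≡ d pm w i j g stat-φ = begin
  + stat d (φ pm i j w) - + stat d w   ≡⟨ cong (λ s → + s - + stat d w) stat-φ ⟩
  + (stat d w + g) - + stat d w        ≡⟨ [+m]-[+n]≡m⊖n (stat d w + g) (stat d w) ⟩
  (stat d w + g) ⊖ stat d w            ≡⟨ ⊖-≥ (m≤m+n (stat d w) g) ⟩
  + (stat d w + g ∸ stat d w)          ≡⟨ cong +_ (m+n∸m≡n (stat d w) g) ⟩
  + g                                  ∎

desB-map-shift : ∀ k w → desB (map (shift (suc k)) w) ≡ desB w
desB-map-shift k w = descents-map (shift (suc k)) (shift-<r k) (0ℤ ∷ w)

desB-φ : ∀ pm k w i → i < length w →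
  let a = entry w i; b = entry w (suc i); v = val pm (suc k) in
  desB (φ pm (suc i) (suc k) w) + bit (b <r a) ≡ desB w + (bit (not (a <r v)) + bit (b <r v))
desB-φ pm k w i i<n = begin
  desB σw + bit (b <r a)                                 ≡⟨ cong (λ c → desB σw + bit c) (shift-<r k b a) ⟨
  desB σw + bit (σ b <r σ a)                             ≡⟨ inserted ⟩
  desB (map σ w) + (bit (v <r σ a) + bit (σ b <r v))
    ≡⟨ cong₂ (λ d c → d + c) (desB-map-shift k w)
             (cong₂ (λ x y → bit x + bit y) (val-<r-shift pm k a) (shift-<r-val pm k b)) ⟩
  desB w + (bit (not (a <r v)) + bit (b <r v))           ∎
  where
  σ = shift (suc k)
  a = entry w i
  b = entry w (suc i)
  v = val pm (suc k)
  σw = φ pm (suc i) (suc k) w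
  inserted : desB σw + bit (σ b <r σ a) ≡ desB (map σ w) + (bit (v <r σ a) + bit (σ b <r v))
  inserted = subst₂ (λ a′ b′ → desB σw + bit (b′ <r a′)
                               ≡ desB (map σ w) + (bit (v <r a′) + bit (b′ <r v)))
               (trans (entry-map σ refl (0ℤ ∷ w) (suc i)) (cong σ (entry-0∷ w i)))
               (entry-map σ refl w (suc i))
               (descents-ins v 0ℤ (map σ w) i (subst (i <_) (sym (length-map σ w)) i<n))

desB-φ-last : ∀ pm k w →
  desB (φ pm (suc (length w)) (suc k) w) ≡ desB w + bit (not (entry w (length w) <r val pm (suc k)))
desB-φ-last pm k w = begin
  descents (0ℤ ∷ ins (length w) v (map σ w))
    ≡⟨ cong (λ m → descents (0ℤ ∷ ins m v (map σ w))) (length-map σ w) ⟨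
  descents (0ℤ ∷ ins (length (map σ w)) v (map σ w))
    ≡⟨ descents-ins-last v 0ℤ (map σ w) ⟩
  desB (map σ w) + bit (v <r last)
    ≡⟨ cong₂ (λ d x → d + bit (v <r x)) (desB-map-shift k w) last≡ ⟩
  desB w + bit (v <r σ (entry w (length w)))
    ≡⟨ cong (λ c → desB w + bit c) (val-<r-shift pm k (entry w (length w))) ⟩
  desB w + bit (not (entry w (length w) <r v))
    ∎
  where
  σ = shift (suc k)
  v = val pm (suc k)
  last = entry (0ℤ ∷ map σ w) (suc (length (map σ w)))
  last≡ : last ≡ σ (entry w (length w))
  last≡ = begin
    last                                       ≡⟨ cong (entry (0ℤ ∷ map σ w) ∘ suc) (length-map σ w) ⟩
    entry (map σ (0ℤ ∷ w)) (suc (length w))    ≡⟨ entry-map σ refl (0ℤ ∷ w) (suc (length w)) ⟩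
    σ (entry (0ℤ ∷ w) (suc (length w)))        ≡⟨ cong σ (entry-0∷ w (length w)) ⟩
    σ (entry w (length w))                     ∎

-- The subtraction in descentGain is exact: the lost descent b <r a forces
-- ¬ a <r v or b <r v.
descent-≤-new-descents : ∀ a b v → bit (b <r a) ≤ bit (not (a <r v)) + bit (b <r v)
descent-≤-new-descents a b v with b <r a in b<a | a <r v in a<v
... | false | _     = z≤n
... | true  | false = s≤s z≤n
... | true  | true  rewrite <r-trans b a v b<a a<v = s≤s z≤n

m+o≡n+p⇒m≡n+[p∸o] : ∀ {m n o p} → m + o ≡ n + p → o ≤ p → m ≡ n + (p ∸ o)
m+o≡n+p⇒m≡n+[p∸o] {m} {n} {o} {p} eq o≤p = begin
  m            ≡⟨ m+n∸n≡m m o ⟨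
  m + o ∸ o    ≡⟨ cong (_∸ o) eq ⟩
  n + p ∸ o    ≡⟨ +-∸-assoc n o≤p ⟩
  n + (p ∸ o)  ∎

dtype-horiz : ∀ n w pm i j → length w ≡ n → 1 ≤ i → i ≤ suc n → 1 ≤ j →
  dtype horiz pm w i j ≡ + descentGain (entry w (i ∸ 1)) (rowBelow n w i) (val pm j)
dtype-horiz _ w pm (suc i) (suc k) refl _ i≤n+1 _ with m≤n⇒m<n∨m≡n i≤n+1
... | inj₁ (s≤s i<n) rewrite rowBelow-≤ (length w) w (suc i) i<n =
  dtype-≡ horiz pm w (suc i) (suc k) _
    (m+o≡n+p⇒m≡n+[p∸o] (desB-φ pm k w i i<n)
                         (descent-≤-new-descents (entry w i) (entry w (suc i)) (val pm (suc k))))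
... | inj₂ refl rewrite rowBelow-> (length w) w (suc (length w)) ≤-refl =
  dtype-≡ horiz pm w (suc (length w)) (suc k) _ (desB-φ-last pm k w)

-- Horizontal paths

module SuccessorPaths (n : ℕ) (w : List ℤ) (pm : PM) (p : ℕ) where
  open Paths n w horiz pm p

  column : GP → ℕ
  column = proj₂

  1≤column : ∀ {u} → Vtx u → 1 ≤ column u
  1≤column ((_ , _ , 1≤j , _) , _) = 1≤j

  column≤ : ∀ {u} → Vtx u → column u ≤ suc n
  column≤ ((_ , _ , _ , j≤n+1) , _) = j≤n+1

  Link-Vtx : ∀ {u u′} → Link u u′ → Vtx u × Vtx u′
  Link-Vtx (line u∈ u′∈)               = u∈ , u′∈
  Link-Vtx (diag _ _ _ u∈ u′∈ _ _ _ _) = u∈ , u′∈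
  Link-Vtx (anti _ _ _ u∈ u′∈ _ _ _ _) = u∈ , u′∈

  -- A rule moving every vertex one column to the right whose steps are
  -- exactly the edges: the p-paths are then its orbits.
  record Successor : Set where
    field
      next           : GP → GP
      column-next    : ∀ u → column (next u) ≡ suc (column u)
      next-rule      : ∀ u → StepRule horiz p pm w u (next u)
      next-step      : ∀ {u} → Vtx u → column u ≤ n → Vtx (next u) × SymClosure Link u (next u)
      Link⇒next      : ∀ {u u′} → Link u u′ → u′ ≡ next u ⊎ u ≡ next u′
      next-injective : ∀ {u u′} → Vtx u → Vtx u′ → next u ≡ next u′ → u ≡ u′
      next-onto      : ∀ {u} → Vtx u → 2 ≤ column u → ∃ λ u′ → Vtx u′ × next u′ ≡ u

  module _ (S : Successor) where
    open Successor S

    orbit : GP → ℕ → GP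
    orbit s zero    = s
    orbit s (suc k) = next (orbit s k)

    column-orbit : ∀ {s} k → column s ≡ 1 → column (orbit s k) ≡ suc k
    column-orbit zero    s-left = s-left
    column-orbit (suc k) s-left = trans (column-next _) (cong suc (column-orbit k s-left))

    leftmost : ∀ c {u} → Vtx u → column u ≡ suc c → ∃ λ s → Vtx s × column s ≡ 1 × orbit s c ≡ u
    leftmost zero    u∈ u-left = _ , u∈ , u-left , refl
    leftmost (suc c) u∈ u-col with next-onto u∈ (subst (2 ≤_) (sym u-col) (s≤s (s≤s z≤n)))
    ... | u′ , u′∈ , refl with leftmost c u′∈ (suc-injective (trans (sym (column-next u′)) u-col))
    ...   | s , s∈ , s-left , refl = s , s∈ , s-left , refl

    module Orbit {s} (s∈ : Vtx s) (s-left : column s ≡ 1) where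

      orbit-step : ∀ k → suc k ≤ n → Vtx (orbit s k) →
                   Vtx (orbit s (suc k)) × SymClosure Link (orbit s k) (orbit s (suc k))
      orbit-step k k<n k∈ = next-step k∈ (subst (_≤ n) (sym (column-orbit k s-left)) k<n)

      orbit-Vtx : ∀ k → k ≤ n → Vtx (orbit s k)
      orbit-Vtx zero    _   = s∈
      orbit-Vtx (suc k) k<n = proj₁ (orbit-step k k<n (orbit-Vtx k (<⇒≤ k<n)))

      orbit-link : ∀ k → suc k ≤ n → SymClosure Link (orbit s k) (orbit s (suc k))
      orbit-link k k<n = proj₂ (orbit-step k k<n (orbit-Vtx k (<⇒≤ k<n)))

      Conn-orbit : ∀ k → k ≤ n → Conn s (orbit s k)
      Conn-orbit zero    _   = ε
      Conn-orbit (suc k) k<n = Conn-orbit k (<⇒≤ k<n) ◅◅ (orbit-link k k<n ◅ ε)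

      OnOrbit : GP → Set
      OnOrbit u = ∃ λ k → k ≤ n × u ≡ orbit s k

      OnOrbit-next : ∀ {u u′} → OnOrbit u → Vtx u′ → u′ ≡ next u → OnOrbit u′
      OnOrbit-next (k , _ , refl) u′∈ refl =
        suc k , ≤-pred (subst (_≤ suc n) (column-orbit (suc k) s-left) (column≤ u′∈)) , refl

      OnOrbit-prev : ∀ {u u′} → OnOrbit u → Vtx u′ → u ≡ next u′ → OnOrbit u′
      OnOrbit-prev {u′ = u′} (zero , _ , refl) u′∈ s≡next =
        contradiction (subst (2 ≤_) column-next-u′≡1 (s≤s (1≤column u′∈))) λ { (s≤s ()) }
        where
        column-next-u′≡1 : suc (column u′) ≡ 1
        column-next-u′≡1 = trans (sym (column-next u′)) (trans (cong column (sym s≡next)) s-left)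
      OnOrbit-prev (suc k , k<n , refl) u′∈ next≡next =
        k , <⇒≤ k<n , next-injective u′∈ (orbit-Vtx k (<⇒≤ k<n)) (sym next≡next)

      OnOrbit-link : ∀ {u u′} → OnOrbit u → SymClosure Link u u′ → OnOrbit u′
      OnOrbit-link on (fwd l) with Link⇒next l
      ... | inj₁ u′≡next = OnOrbit-next on (proj₂ (Link-Vtx l)) u′≡next
      ... | inj₂ u≡next  = OnOrbit-prev on (proj₂ (Link-Vtx l)) u≡next
      OnOrbit-link on (bwd l) with Link⇒next l
      ... | inj₁ u≡next  = OnOrbit-prev on (proj₁ (Link-Vtx l)) u≡next
      ... | inj₂ u′≡next = OnOrbit-next on (proj₁ (Link-Vtx l)) u′≡next

      OnOrbit-Conn : ∀ {u u′} → OnOrbit u → Conn u u′ → OnOrbit u′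
      OnOrbit-Conn on ε        = on
      OnOrbit-Conn on (l ◅ ls) = OnOrbit-Conn (OnOrbit-link on l) ls

    describedPath : ∀ v → Vtx v → Σ (ℕ → GP) (DescribedPath v)
    describedPath (i , zero)  v∈ = contradiction (1≤column v∈) λ ()
    describedPath (i , suc c) v∈ with leftmost c v∈ refl
    ... | s , s∈ , s-left , orbit≡v =
      γ , s-left , column-orbit n s-left , steps , members
      where
      open Orbit s∈ s-left
      γ : ℕ → GP
      γ t = orbit s (t ∸ 1)
      c≤n : c ≤ n
      c≤n = ≤-pred (column≤ v∈)
      steps : ∀ t → 1 ≤ t → t ≤ n →
              StepRule horiz p pm w (γ t) (γ (suc t)) × SymClosure Link (γ t) (γ (suc t))
      steps (suc t) _ t<n = next-rule (orbit s t) , orbit-link t t<n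
      members : ∀ u → Conn (i , suc c) u ⇔ (Σ ℕ λ t → 1 ≤ t × t ≤ suc n × u ≡ γ t)
      members u = mk⇔ to from
        where
        to : Conn (i , suc c) u → Σ ℕ λ t → 1 ≤ t × t ≤ suc n × u ≡ γ t
        to conn with OnOrbit-Conn (c , c≤n , sym orbit≡v) conn
        ... | k , k≤n , u≡ = suc k , s≤s z≤n , s≤s k≤n , u≡
        from : (Σ ℕ λ t → 1 ≤ t × t ≤ suc n × u ≡ γ t) → Conn (i , suc c) u
        from (suc k , _ , s≤s k≤n , refl) =
          reverse (symmetric Link) (subst (Conn s) orbit≡v (Conn-orbit c c≤n)) ◅◅ Conn-orbit k k≤n

-- All that the horizontal analysis uses about π: the word 0 π₁ ⋯ πₙ has no
-- two equal neighbours.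
record AdjacentDistinct (n : ℕ) (w : List ℤ) : Set where
  field
    length≡ : length w ≡ n
    entry≢entry-suc : ∀ i → i < n → entry w i ≢ entry w (suc i)

val≢0 : ∀ pm k → val pm (suc k) ≢ 0ℤ
val≢0 plus  k ()
val≢0 minus k ()

entry≢0⇒bounds : ∀ w i → entry w i ≢ 0ℤ → 1 ≤ i × i ≤ length w
entry≢0⇒bounds []       i             w≢0 = contradiction refl w≢0
entry≢0⇒bounds (x ∷ xs) zero          w≢0 = contradiction refl w≢0
entry≢0⇒bounds (x ∷ xs) (suc zero)    _   = s≤s z≤n , s≤s z≤n
entry≢0⇒bounds (x ∷ xs) (suc (suc i)) w≢0 with entry≢0⇒bounds xs (suc i) w≢0
... | _ , i<n = s≤s z≤n , s≤s i<n

Sq⇒bounds : ∀ pm w i j → Sq pm w i j → 1 ≤ i × i ≤ length w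
Sq⇒bounds pm w i (suc k) (_ , eq) = entry≢0⇒bounds w i (λ e → val≢0 pm k (trans (sym eq) e))

Sq? : ∀ pm w i j → Dec (Sq pm w i j)
Sq? pm w i j = (1 ≤? j) ×-dec (entry w i ≟ val pm j)

module HorizontalTypes {n w} (pm : PM) (adj : AdjacentDistinct n w) where
  open AdjacentDistinct adj

  type : ℕ → ℕ → ℕ
  type i j = descentGain (entry w (i ∸ 1)) (rowBelow n w i) (val pm j)

  dtype≡type : ∀ {i j} → InGrid n (i , j) → dtype horiz pm w i j ≡ + type i j
  dtype≡type (1≤i , i≤n+1 , 1≤j , _) = dtype-horiz n w pm _ _ length≡ 1≤i i≤n+1 1≤j

  Sq⇒row≤ : ∀ {i j} → Sq pm w i j → i ≤ n
  Sq⇒row≤ {i} {j} sq = subst (i ≤_) length≡ (proj₂ (Sq⇒bounds pm w i j sq))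

  rowBelow≢ : ∀ {i x} → entry w i ≢ x → rowBelow n w i ≢ just x
  rowBelow≢ {i} w≢x with i ≤? n
  ... | yes _ = w≢x ∘ just-injective
  ... | no  _ = λ ()

  rowBelow-suc≢ : ∀ i → rowBelow n w (suc i) ≢ just (entry w i)
  rowBelow-suc≢ i with suc i ≤? n
  ... | yes i<n = entry≢entry-suc i i<n ∘ sym ∘ just-injective
  ... | no  _   = λ ()

  type-bottomLeft : ∀ {i k} → Sq pm w i (suc k) → type (suc i) (suc k) ≡ 1
  type-bottomLeft {i} (_ , eq) = descentGain-after-equal (rowBelow n w (suc i)) eq

  type-bottomRight : ∀ {i k} → Sq pm w i (suc k) → type (suc i) (suc (suc k)) ≡ 0
  type-bottomRight {i} {k} (_ , eq) = descentGain-after-pred pm k _ eq (rowBelow-suc≢ i)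

  type-topLeft : ∀ {i k} → Sq pm w i (suc k) → type i (suc k) ≡ 0
  type-topLeft {zero}  sq = contradiction (proj₁ (Sq⇒bounds pm w 0 _ sq)) λ ()
  type-topLeft {suc i} sq@(_ , eq) rewrite rowBelow-≤ n w (suc i) (Sq⇒row≤ sq) =
    descentGain-before-equal eq (entry≢entry-suc i (Sq⇒row≤ sq))

  type-topRight : ∀ {i k} → Sq pm w i (suc k) → type i (suc (suc k)) ≡ 1
  type-topRight {zero}      sq = contradiction (proj₁ (Sq⇒bounds pm w 0 _ sq)) λ ()
  type-topRight {suc i} {k} sq@(_ , eq) rewrite rowBelow-≤ n w (suc i) (Sq⇒row≤ sq) =
    descentGain-before-pred pm k eq (entry≢entry-suc i (Sq⇒row≤ sq))

  type-suc : ∀ {i k} → ¬ Sq pm w (i ∸ 1) (suc k) → ¬ Sq pm w i (suc k) →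
             type i (suc k) ≡ type i (suc (suc k))
  type-suc {i} {k} ¬sq↑ ¬sq↓ =
    descentGain-val-suc pm k _ _ (λ e → ¬sq↑ (s≤s z≤n , e)) (rowBelow≢ (λ e → ¬sq↓ (s≤s z≤n , e)))

module HorizontalVertices {n w} (pm : PM) (adj : AdjacentDistinct n w) (p : ℕ) where
  open Paths n w horiz pm p
  open HorizontalTypes pm adj public

  Vtx⇒type : ∀ {i j} → Vtx (i , j) → type i j ≡ p
  Vtx⇒type (ig , dtype≡p) = +-injective (trans (sym (dtype≡type ig)) dtype≡p)

  type⇒Vtx : ∀ {i j} → InGrid n (i , j) → type i j ≡ p → Vtx (i , j)
  type⇒Vtx ig type≡p = ig , trans (dtype≡type ig) (cong +_ type≡p)

  InGrid-sameRow : ∀ {i j j′} → InGrid n (i , j) → 1 ≤ j′ → j′ ≤ suc n → InGrid n (i , j′)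
  InGrid-sameRow (1≤i , i≤n+1 , _ , _) 1≤j′ j′≤n+1 = 1≤i , i≤n+1 , 1≤j′ , j′≤n+1

  ¬Vtx-of-type : ∀ {i j q} → type i j ≡ q → q ≢ p → ¬ Vtx (i , j)
  ¬Vtx-of-type type≡q q≢p u∈ = q≢p (trans (sym type≡q) (Vtx⇒type u∈))

module ZeroSuccessor {n w} (pm : PM) (adj : AdjacentDistinct n w) where
  open Paths n w horiz pm 0
  open HorizontalVertices pm adj 0
  open SuccessorPaths n w pm 0 using (Successor; column; column≤)

  next : GP → GP
  next (i , j) with Sq? pm w i j
  ... | yes _ = (suc i , suc j)
  ... | no  _ = (i , suc j)

  next-filled : ∀ {i j} → Sq pm w i j → next (i , j) ≡ (suc i , suc j)
  next-filled {i} {j} sq with Sq? pm w i j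
  ... | yes _  = refl
  ... | no ¬sq = contradiction sq ¬sq

  next-empty : ∀ {i j} → ¬ Sq pm w i j → next (i , j) ≡ (i , suc j)
  next-empty {i} {j} ¬sq with Sq? pm w i j
  ... | yes sq = contradiction sq ¬sq
  ... | no  _  = refl

  column-next : ∀ u → column (next u) ≡ suc (column u)
  column-next (i , j) with Sq? pm w i j
  ... | yes _ = refl
  ... | no  _ = refl

  next-step : ∀ {u} → Vtx u → column u ≤ n → Vtx (next u) × SymClosure Link u (next u)
  next-step {zero  , _}     ((() , _) , _) _
  next-step {suc i , zero}  ((_ , _ , () , _) , _) _
  next-step {suc i , suc k} u∈ k<n with Sq? pm w (suc i) (suc k)
  ... | yes sq = u′∈ , fwd (diag (suc i) (suc k) sq u∈ u′∈ (inj₁ ¬right) (inj₂ ¬left)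
                               (λ full → ¬right (full (suc (suc k)) (s≤s z≤n) (s≤s k<n)))
                               (λ full → ¬left (full (suc k) (s≤s z≤n) (column≤ u∈))))
    where
    u′∈ : Vtx (suc (suc i) , suc (suc k))
    u′∈ = type⇒Vtx (s≤s z≤n , s≤s (Sq⇒row≤ sq) , s≤s z≤n , s≤s k<n) (type-bottomRight sq)
    ¬right : ¬ Vtx (suc i , suc (suc k))
    ¬right = ¬Vtx-of-type (type-topRight sq) λ ()
    ¬left : ¬ Vtx (suc (suc i) , suc k)
    ¬left = ¬Vtx-of-type (type-bottomLeft sq) λ ()
  ... | no ¬sq = u′∈ , fwd (line u∈ u′∈)
    where
    ¬sq↑ : ¬ Sq pm w i (suc k)
    ¬sq↑ sq = ¬Vtx-of-type (type-bottomLeft sq) (λ ()) u∈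
    u′∈ : Vtx (suc i , suc (suc k))
    u′∈ = type⇒Vtx (InGrid-sameRow (proj₁ u∈) (s≤s z≤n) (s≤s k<n))
                   (trans (sym (type-suc ¬sq↑ ¬sq)) (Vtx⇒type u∈))

  Link⇒next : ∀ {u u′} → Link u u′ → u′ ≡ next u ⊎ u ≡ next u′
  Link⇒next (line {i , zero}  ((_ , _ , () , _) , _) _)
  Link⇒next (line {i , suc k} _ u′∈) with Sq? pm w i (suc k)
  ... | yes sq = contradiction u′∈ (¬Vtx-of-type (type-topRight sq) λ ())
  ... | no  _  = inj₁ refl
  Link⇒next (diag i j sq _ _ _ _ _ _) = inj₁ (sym (next-filled sq))
  Link⇒next (anti i zero    (() , _) _ _ _ _ _ _)
  Link⇒next (anti i (suc k) sq _ u′∈ _ _ _ _) = contradiction u′∈ (¬Vtx-of-type (type-bottomLeft sq) λ ())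

  next-injective : ∀ {u u′} → Vtx u → Vtx u′ → next u ≡ next u′ → u ≡ u′
  next-injective {i , j} {i′ , j′} u∈ u′∈ eq with Sq? pm w i j | Sq? pm w i′ j′
  next-injective _ _ refl | yes _ | yes _ = refl
  next-injective _ _ refl | no  _ | no  _ = refl
  next-injective {_ , zero}  _ _   _    | yes (() , _) | no _
  next-injective {_ , suc k} _ u′∈ refl | yes sq       | no _ =
    contradiction u′∈ (¬Vtx-of-type (type-bottomLeft sq) λ ())
  next-injective {_ , _} {_ , zero}  _ _  _    | no _ | yes (() , _)
  next-injective {_ , _} {_ , suc k} u∈ _ refl | no _ | yes sq =
    contradiction u∈ (¬Vtx-of-type (type-bottomLeft sq) λ ())

  next-onto : ∀ {u} → Vtx u → 2 ≤ column u → ∃ λ u′ → Vtx u′ × next u′ ≡ u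
  next-onto {zero  , _}            ((() , _) , _) _
  next-onto {suc i , suc (suc k)} u∈ (s≤s (s≤s z≤n)) with Sq? pm w i (suc k)
  ... | yes sq = (i , suc k) , u′∈ , next-filled sq
    where
    u′∈ : Vtx (i , suc k)
    u′∈ = type⇒Vtx (proj₁ (Sq⇒bounds pm w i _ sq) , m≤n⇒m≤1+n (Sq⇒row≤ sq) ,
                    s≤s z≤n , m≤n⇒m≤1+n (≤-pred (column≤ u∈)))
                   (type-topLeft sq)
  ... | no ¬sq↑ = (suc i , suc k) , u′∈ , next-empty ¬sq↓
    where
    ¬sq↓ : ¬ Sq pm w (suc i) (suc k)
    ¬sq↓ sq = ¬Vtx-of-type (type-topRight sq) (λ ()) u∈
    u′∈ : Vtx (suc i , suc k)
    u′∈ = type⇒Vtx (InGrid-sameRow (proj₁ u∈) (s≤s z≤n) (m≤n⇒m≤1+n (≤-pred (column≤ u∈))))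
                   (trans (type-suc ¬sq↑ ¬sq↓) (Vtx⇒type u∈))

  successor : Successor
  successor = record
    { next = next ; column-next = column-next
    ; next-rule = λ (i , j) → next-filled , next-empty
    ; next-step = next-step ; Link⇒next = Link⇒next
    ; next-injective = next-injective ; next-onto = next-onto }

module OneSuccessor {n w} (pm : PM) (adj : AdjacentDistinct n w) where
  open Paths n w horiz pm 1
  open HorizontalVertices pm adj 1
  open SuccessorPaths n w pm 1 using (Successor; column; column≤)

  next : GP → GP
  next (i , j) with Sq? pm w (i ∸ 1) j
  ... | yes _ = (i ∸ 1 , suc j)
  ... | no  _ = (i , suc j)

  next-filled : ∀ {i j} → Sq pm w (i ∸ 1) j → next (i , j) ≡ (i ∸ 1 , suc j)
  next-filled {i} {j} sq with Sq? pm w (i ∸ 1) j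
  ... | yes _  = refl
  ... | no ¬sq = contradiction sq ¬sq

  next-empty : ∀ {i j} → ¬ Sq pm w (i ∸ 1) j → next (i , j) ≡ (i , suc j)
  next-empty {i} {j} ¬sq with Sq? pm w (i ∸ 1) j
  ... | yes sq = contradiction sq ¬sq
  ... | no  _  = refl

  column-next : ∀ u → column (next u) ≡ suc (column u)
  column-next (i , j) with Sq? pm w (i ∸ 1) j
  ... | yes _ = refl
  ... | no  _ = refl

  next-step : ∀ {u} → Vtx u → column u ≤ n → Vtx (next u) × SymClosure Link u (next u)
  next-step {zero  , _}     ((() , _) , _) _
  next-step {suc i , zero}  ((_ , _ , () , _) , _) _
  next-step {suc i , suc k} u∈ k<n with Sq? pm w i (suc k)
  ... | yes sq = u′∈ , bwd (anti i (suc k) sq u′∈ u∈ (inj₂ ¬left) (inj₁ ¬right)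
                               (λ full → ¬left (full (suc k) (s≤s z≤n) (column≤ u∈)))
                               (λ full → ¬right (full (suc (suc k)) (s≤s z≤n) (s≤s k<n))))
    where
    u′∈ : Vtx (i , suc (suc k))
    u′∈ = type⇒Vtx (proj₁ (Sq⇒bounds pm w i _ sq) , m≤n⇒m≤1+n (Sq⇒row≤ sq) , s≤s z≤n , s≤s k<n)
                   (type-topRight sq)
    ¬left : ¬ Vtx (i , suc k)
    ¬left = ¬Vtx-of-type (type-topLeft sq) λ ()
    ¬right : ¬ Vtx (suc i , suc (suc k))
    ¬right = ¬Vtx-of-type (type-bottomRight sq) λ ()
  ... | no ¬sq = u′∈ , fwd (line u∈ u′∈)
    where
    ¬sq↓ : ¬ Sq pm w (suc i) (suc k)
    ¬sq↓ sq = ¬Vtx-of-type (type-topLeft sq) (λ ()) u∈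
    u′∈ : Vtx (suc i , suc (suc k))
    u′∈ = type⇒Vtx (InGrid-sameRow (proj₁ u∈) (s≤s z≤n) (s≤s k<n))
                   (trans (sym (type-suc ¬sq ¬sq↓)) (Vtx⇒type u∈))

  Link⇒next : ∀ {u u′} → Link u u′ → u′ ≡ next u ⊎ u ≡ next u′
  Link⇒next (line {zero  , _}     ((() , _) , _) _)
  Link⇒next (line {suc i , zero}  ((_ , _ , () , _) , _) _)
  Link⇒next (line {suc i , suc k} _ u′∈) with Sq? pm w i (suc k)
  ... | yes sq = contradiction u′∈ (¬Vtx-of-type (type-bottomRight sq) λ ())
  ... | no  _  = inj₁ refl
  Link⇒next (diag i zero    (() , _) _ _ _ _ _ _)
  Link⇒next (diag i (suc k) sq _ u′∈ _ _ _ _) = contradiction u′∈ (¬Vtx-of-type (type-bottomRight sq) λ ())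
  Link⇒next (anti i j sq _ _ _ _ _ _) = inj₂ (sym (next-filled sq))

  next-injective : ∀ {u u′} → Vtx u → Vtx u′ → next u ≡ next u′ → u ≡ u′
  next-injective {zero , _} ((() , _) , _) _ _
  next-injective {_ , _} {zero , _} _ ((() , _) , _) _
  next-injective {suc a , j} {suc b , j′} u∈ u′∈ eq with Sq? pm w a j | Sq? pm w b j′
  next-injective _ _ refl | yes _ | yes _ = refl
  next-injective _ _ refl | no  _ | no  _ = refl
  next-injective {_ , zero}  _ _   _    | yes (() , _) | no _
  next-injective {_ , suc k} _ u′∈ refl | yes sq       | no _ =
    contradiction u′∈ (¬Vtx-of-type (type-topLeft sq) λ ())
  next-injective {_ , _} {_ , zero}  _ _  _    | no _ | yes (() , _)
  next-injective {_ , _} {_ , suc k} u∈ _ refl | no _ | yes sq =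
    contradiction u∈ (¬Vtx-of-type (type-topLeft sq) λ ())

  next-onto : ∀ {u} → Vtx u → 2 ≤ column u → ∃ λ u′ → Vtx u′ × next u′ ≡ u
  next-onto {zero  , _}            ((() , _) , _) _
  next-onto {suc i , suc (suc k)} u∈ (s≤s (s≤s z≤n)) with Sq? pm w (suc i) (suc k)
  ... | yes sq = (suc (suc i) , suc k) , u′∈ , next-filled sq
    where
    u′∈ : Vtx (suc (suc i) , suc k)
    u′∈ = type⇒Vtx (s≤s z≤n , s≤s (Sq⇒row≤ sq) , s≤s z≤n , m≤n⇒m≤1+n (≤-pred (column≤ u∈)))
                   (type-bottomLeft sq)
  ... | no ¬sq↓ = (suc i , suc k) , u′∈ , next-empty ¬sq↑
    where
    ¬sq↑ : ¬ Sq pm w i (suc k)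
    ¬sq↑ sq = ¬Vtx-of-type (type-bottomRight sq) (λ ()) u∈
    u′∈ : Vtx (suc i , suc k)
    u′∈ = type⇒Vtx (InGrid-sameRow (proj₁ u∈) (s≤s z≤n) (m≤n⇒m≤1+n (≤-pred (column≤ u∈))))
                   (trans (type-suc ¬sq↑ ¬sq↓) (Vtx⇒type u∈))

  successor : Successor
  successor = record
    { next = next ; column-next = column-next
    ; next-rule = λ (i , j) → next-filled , next-empty
    ; next-step = next-step ; Link⇒next = Link⇒next
    ; next-injective = next-injective ; next-onto = next-onto }

horizontalPaths : ∀ {n w} pm → AdjacentDistinct n w → ∀ p → p ≤ 1 → ∀ v → Paths.Vtx n w horiz pm p v →
                  Σ (ℕ → GP) (Paths.DescribedPath n w horiz pm p v)
horizontalPaths {n} {w} pm adj 0 _ = SuccessorPaths.describedPath n w pm 0 (ZeroSuccessor.successor pm adj)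
horizontalPaths {n} {w} pm adj 1 _ = SuccessorPaths.describedPath n w pm 1 (OneSuccessor.successor pm adj)
horizontalPaths pm adj (suc (suc p)) (s≤s ())

-- Inverting an insertion

≡⇒≡ᵇ≡true : ∀ {m n} → m ≡ n → (m ≡ᵇ n) ≡ true
≡⇒≡ᵇ≡true {m} {n} m≡n = Equivalence.to T-≡ (≡⇒≡ᵇ m n m≡n)

≢⇒≡ᵇ≡false : ∀ {m n} → m ≢ n → (m ≡ᵇ n) ≡ false
≢⇒≡ᵇ≡false {m} {n} m≢n with m ≡ᵇ n in e
... | true  = contradiction (≡ᵇ⇒≡ m n (Equivalence.from T-≡ e)) m≢n
... | false = refl

shiftℕ-≡ᵇ-below : ∀ j a k → k < j → (shiftℕ j a ≡ᵇ k) ≡ (a ≡ᵇ k)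
shiftℕ-≡ᵇ-below (suc j) zero    zero    _         = refl
shiftℕ-≡ᵇ-below (suc j) (suc a) zero    _         rewrite shiftℕ-suc j a = refl
shiftℕ-≡ᵇ-below (suc j) zero    (suc k) _         = refl
shiftℕ-≡ᵇ-below (suc j) (suc a) (suc k) (s≤s k<j) rewrite shiftℕ-suc j a = shiftℕ-≡ᵇ-below j a k k<j

shiftℕ-≡ᵇ-above : ∀ j a k → j ≤ k → (shiftℕ j a ≡ᵇ suc k) ≡ (a ≡ᵇ k)
shiftℕ-≡ᵇ-above zero    a       k       _         = refl
shiftℕ-≡ᵇ-above (suc j) zero    (suc k) _         = refl
shiftℕ-≡ᵇ-above (suc j) (suc a) (suc k) (s≤s j≤k) rewrite shiftℕ-suc j a = shiftℕ-≡ᵇ-above j a k j≤k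

shiftℕ-≢ : ∀ j a → shiftℕ j a ≢ j
shiftℕ-≢ zero    a       ()
shiftℕ-≢ (suc j) zero    ()
shiftℕ-≢ (suc j) (suc a) e rewrite shiftℕ-suc j a = shiftℕ-≢ j a (suc-injective e)

∣shift∣ : ∀ j x → ∣ shift (suc j) x ∣ ≡ shiftℕ (suc j) ∣ x ∣
∣shift∣ j (+ a)    rewrite shift-+ j a      = refl
∣shift∣ j -[1+ a ] rewrite shift--[1+] j a = sym (shiftℕ-suc j a)

sgnTimes-shift : ∀ j x m → sgnTimes (shift (suc j) x) m ≡ sgnTimes x m
sgnTimes-shift j (+ a)    m rewrite shift-+ j a      = refl
sgnTimes-shift j -[1+ a ] m rewrite shift--[1+] j a = refl

∣sgnTimes∣ : ∀ x m → ∣ sgnTimes x m ∣ ≡ m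
∣sgnTimes∣ (+ a)    m       = refl
∣sgnTimes∣ -[1+ a ] zero    = refl
∣sgnTimes∣ -[1+ a ] (suc m) = refl

∣val∣ : ∀ pm m → ∣ val pm m ∣ ≡ m
∣val∣ plus  m       = refl
∣val∣ minus zero    = refl
∣val∣ minus (suc m) = refl

sgnTimes-val : ∀ pm j m → sgnTimes (val pm (suc j)) m ≡ val pm m
sgnTimes-val plus  j m = refl
sgnTimes-val minus j m = refl

sgnTimes≡val : ∀ pm x m i j → ∣ x ∣ ≡ suc j → sgnTimes x m ≡ val pm (suc i) →
               x ≡ val pm (suc j) × m ≡ suc i
sgnTimes≡val plus  (+ a)    m       i j refl refl = refl , refl
sgnTimes≡val minus -[1+ a ] (suc m) i j refl refl = refl , refl
sgnTimes≡val plus  -[1+ a ] zero    i j _    ()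
sgnTimes≡val plus  -[1+ a ] (suc m) i j _    ()
sgnTimes≡val minus (+ a)    m       i j _    ()
sgnTimes≡val minus -[1+ a ] zero    i j _    ()

shift-sgnTimes-< : ∀ x m t → 1 ≤ m → m < t → shift t (sgnTimes x m) ≡ sgnTimes x m
shift-sgnTimes-< (+ a)    m       t _ m<t rewrite <⇒<ᵇ≡true m<t = refl
shift-sgnTimes-< -[1+ a ] (suc m) t _ m<t rewrite <⇒<ᵇ≡true m<t = refl

shift-sgnTimes-≥ : ∀ x m t → 1 ≤ m → t ≤ m → shift t (sgnTimes x m) ≡ sgnTimes x (suc m)
shift-sgnTimes-≥ (+ a)    m       t _ t≤m rewrite ≤⇒>ᵇ≡false {m} t≤m = refl
shift-sgnTimes-≥ -[1+ a ] (suc m) t _ t≤m rewrite ≤⇒>ᵇ≡false {suc m} t≤m = refl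

posOf-occurrence : ∀ k L m i → i < length L → ∣ entry L (suc i) ∣ ≡ k →
  ∃ λ i′ → i′ < length L × ∣ entry L (suc i′) ∣ ≡ k
         × posOf k L m ≡ sgnTimes (entry L (suc i′)) (m + i′)
posOf-occurrence k (x ∷ L) m i i<n ∣x∣≡k with ∣ x ∣ ≡ᵇ k in found
... | true =
  0 , s≤s z≤n , ≡ᵇ⇒≡ ∣ x ∣ k (Equivalence.from T-≡ found) , cong (sgnTimes x) (sym (+-identityʳ m))
posOf-occurrence k (x ∷ L) m zero    _         ∣x∣≡k | false =
  contradiction (trans (sym (≡⇒≡ᵇ≡true ∣x∣≡k)) found) λ ()
posOf-occurrence k (x ∷ L) m (suc i) (s≤s i<n) ∣x∣≡k | false
  with posOf-occurrence k L (suc m) i i<n ∣x∣≡k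
... | i′ , i′<n , found′ , pos =
  suc i′ , s≤s i′<n , found′ , trans pos (cong (sgnTimes (entry L (suc i′))) (sym (+-suc m i′)))

posOf-shift : ∀ k L m t → 1 ≤ t → t ≤ m → shift t (posOf k L m) ≡ posOf k L (suc m)
posOf-shift k []       m (suc t) _   _   = refl
posOf-shift k (x ∷ L) m t       1≤t t≤m with ∣ x ∣ ≡ᵇ k
... | true  = shift-sgnTimes-≥ x m t (≤-trans 1≤t t≤m) t≤m
... | false = posOf-shift k L (suc m) t 1≤t (≤-trans t≤m (n≤1+n m))

posOf-ins-other : ∀ k v q L m → ∣ v ∣ ≢ k → 1 ≤ m →
                  posOf k (ins q v L) m ≡ shift (m + q) (posOf k L m)
posOf-ins-other k v zero L m ∣v∣≢k 1≤m rewrite ≢⇒≡ᵇ≡false ∣v∣≢k | +-identityʳ m =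
  sym (posOf-shift k L m m 1≤m ≤-refl)
posOf-ins-other k v (suc q) [] m ∣v∣≢k _ rewrite ≢⇒≡ᵇ≡false ∣v∣≢k | +-suc m q = refl
posOf-ins-other k v (suc q) (x ∷ L) m ∣v∣≢k 1≤m with ∣ x ∣ ≡ᵇ k
... | true  = sym (shift-sgnTimes-< x m (m + suc q) 1≤m (m<m+n m (s≤s z≤n)))
... | false = trans (posOf-ins-other k v q L (suc m) ∣v∣≢k (≤-trans 1≤m (n≤1+n m)))
                    (cong (λ t → shift t (posOf k L (suc m))) (sym (+-suc m q)))

posOf-ins-self : ∀ k v q (g : ℤ → ℤ) L m → ∣ v ∣ ≡ k → (∀ x → ∣ g x ∣ ≢ k) → q ≤ length L →
                 posOf k (ins q v (map g L)) m ≡ sgnTimes v (m + q)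
posOf-ins-self k v zero    g L       m ∣v∣≡k _  _ rewrite ≡⇒≡ᵇ≡true ∣v∣≡k =
  cong (sgnTimes v) (sym (+-identityʳ m))
posOf-ins-self k v (suc q) g (x ∷ L) m ∣v∣≡k g≢k (s≤s q≤n) rewrite ≢⇒≡ᵇ≡false (g≢k x) =
  trans (posOf-ins-self k v q g L (suc m) ∣v∣≡k g≢k q≤n) (cong (sgnTimes v) (sym (+-suc m q)))

posOf-map : ∀ (g : ℤ → ℤ) k k′ → (∀ x → (∣ g x ∣ ≡ᵇ k) ≡ (∣ x ∣ ≡ᵇ k′)) →
            (∀ x m → sgnTimes (g x) m ≡ sgnTimes x m) → ∀ L m → posOf k (map g L) m ≡ posOf k′ L m
posOf-map g k k′ g-found g-sgn []      m = refl
posOf-map g k k′ g-found g-sgn (x ∷ L) m rewrite g-found x | g-sgn x m with ∣ x ∣ ≡ᵇ k′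
... | true  = refl
... | false = posOf-map g k k′ g-found g-sgn L (suc m)

length-ins : ∀ q v L → length (ins q v L) ≡ suc (length L)
length-ins zero    v L       = refl
length-ins (suc q) v []      = refl
length-ins (suc q) v (x ∷ L) = cong suc (length-ins q v L)

entry-ins-< : ∀ q v L k → q ≤ length L → k < q → entry (ins q v L) (suc k) ≡ entry L (suc k)
entry-ins-< (suc q) v (x ∷ L) zero    _         _         = refl
entry-ins-< (suc q) v (x ∷ L) (suc k) (s≤s q≤n) (s≤s k<q) = entry-ins-< q v L k q≤n k<q

entry-ins-≡ : ∀ q v L → q ≤ length L → entry (ins q v L) (suc q) ≡ v
entry-ins-≡ zero    v L       _         = refl
entry-ins-≡ (suc q) v (x ∷ L) (s≤s q≤n) = entry-ins-≡ q v L q≤n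

entry-ins-> : ∀ q v L k → q ≤ k → entry (ins q v L) (suc (suc k)) ≡ entry L (suc k)
entry-ins-> zero    v L       k       _         = refl
entry-ins-> (suc q) v []      (suc k) _         = refl
entry-ins-> (suc q) v (x ∷ L) (suc k) (s≤s q≤k) = entry-ins-> q v L k q≤k

entry-ext : ∀ L L′ → length L ≡ length L′ →
            (∀ k → k < length L → entry L (suc k) ≡ entry L′ (suc k)) → L ≡ L′
entry-ext []      []        _   _       = refl
entry-ext (x ∷ L) (x′ ∷ L′) len entries =
  cong₂ _∷_ (entries 0 (s≤s z≤n))
            (entry-ext L L′ (suc-injective len) (λ k k<n → entries (suc k) (s≤s k<n)))

entry-applyUpTo : ∀ (h : ℕ → ℤ) N k → k < N → entry (applyUpTo h N) (suc k) ≡ h k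
entry-applyUpTo h (suc N) zero    _         = refl
entry-applyUpTo h (suc N) (suc k) (s≤s k<N) = entry-applyUpTo (h ∘ suc) N k k<N

invB≡applyUpTo : ∀ w → invB w ≡ applyUpTo (λ k → posOf (suc k) w 1) (length w)
invB≡applyUpTo w = trans (cong (map (λ k → posOf k w 1)) (map-upTo suc (length w)))
                         (map-applyUpTo suc (λ k → posOf k w 1) (length w))

length-invB : ∀ w → length (invB w) ≡ length w
length-invB w = trans (cong length (invB≡applyUpTo w)) (length-applyUpTo _ (length w))

entry-invB : ∀ w k → k < length w → entry (invB w) (suc k) ≡ posOf (suc k) w 1
entry-invB w k k<n rewrite invB≡applyUpTo w = entry-applyUpTo _ (length w) k k<n

module _ (pm : PM) (w : List ℤ) {i j : ℕ} (i≤n : i ≤ length w) (j≤n : j ≤ length w) where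
  private
    v = val pm (suc j)
    σ = φ pm (suc i) (suc j) w
    W = invB w
    τ = φ pm (suc j) (suc i) W

    length-σ : length σ ≡ suc (length w)
    length-σ = trans (length-ins i v _) (cong suc (length-map _ w))

    length-shifted-W : length (map (shift (suc i)) W) ≡ length w
    length-shifted-W = trans (length-map _ W) (length-invB w)

    j≤shifted-W : j ≤ length (map (shift (suc i)) W)
    j≤shifted-W = subst (j ≤_) (sym length-shifted-W) j≤n

    entry-σ⁻¹ : ∀ k → k < suc (length w) → entry (invB σ) (suc k) ≡ posOf (suc k) σ 1
    entry-σ⁻¹ k k<n = entry-invB σ k (subst (k <_) (sym length-σ) k<n)

    entry-shifted-W : ∀ k → k < length w →
                      entry (map (shift (suc i)) W) (suc k) ≡ shift (suc i) (posOf (suc k) w 1)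
    entry-shifted-W k k<n = trans (entry-map _ refl W (suc k)) (cong (shift (suc i)) (entry-invB w k k<n))

    posOf-σ : ∀ k → suc k ≢ suc j →
              posOf (suc k) σ 1 ≡ shift (suc i) (posOf (suc k) (map (shift (suc j)) w) 1)
    posOf-σ k k≢j =
      posOf-ins-other (suc k) v i _ 1 (λ e → k≢j (trans (sym e) (∣val∣ pm (suc j)))) (s≤s z≤n)

    entry-below : ∀ k → k < j → entry (invB σ) (suc k) ≡ entry τ (suc k)
    entry-below k k<j = begin
      entry (invB σ) (suc k)
        ≡⟨ entry-σ⁻¹ k (≤-trans k<j (m≤n⇒m≤1+n j≤n)) ⟩
      posOf (suc k) σ 1
        ≡⟨ posOf-σ k (λ e → <-irrefl (suc-injective e) k<j) ⟩
      shift (suc i) (posOf (suc k) (map (shift (suc j)) w) 1)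
        ≡⟨ cong (shift (suc i)) (posOf-map _ _ _ unshifted (sgnTimes-shift j) w 1) ⟩
      shift (suc i) (posOf (suc k) w 1)
        ≡⟨ entry-shifted-W k (<-≤-trans k<j j≤n) ⟨
      entry (map (shift (suc i)) W) (suc k)
        ≡⟨ entry-ins-< j _ _ k j≤shifted-W k<j ⟨
      entry τ (suc k)
        ∎
      where
      unshifted : ∀ x → (∣ shift (suc j) x ∣ ≡ᵇ suc k) ≡ (∣ x ∣ ≡ᵇ suc k)
      unshifted x = trans (cong (_≡ᵇ suc k) (∣shift∣ j x))
                          (shiftℕ-≡ᵇ-below (suc j) ∣ x ∣ (suc k) (s≤s k<j))

    entry-at : entry (invB σ) (suc j) ≡ entry τ (suc j)
    entry-at = begin
      entry (invB σ) (suc j)   ≡⟨ entry-σ⁻¹ j (s≤s j≤n) ⟩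
      posOf (suc j) σ 1        ≡⟨ posOf-ins-self (suc j) v i _ w 1 (∣val∣ pm (suc j)) shifted≢ i≤n ⟩
      sgnTimes v (suc i)       ≡⟨ sgnTimes-val pm j (suc i) ⟩
      val pm (suc i)           ≡⟨ entry-ins-≡ j _ _ j≤shifted-W ⟨
      entry τ (suc j)          ∎
      where
      shifted≢ : ∀ x → ∣ shift (suc j) x ∣ ≢ suc j
      shifted≢ x e = shiftℕ-≢ (suc j) ∣ x ∣ (trans (sym (∣shift∣ j x)) e)

    entry-above : ∀ k → j ≤ k → k < length w → entry (invB σ) (suc (suc k)) ≡ entry τ (suc (suc k))
    entry-above k j≤k k<n = begin
      entry (invB σ) (suc (suc k))
        ≡⟨ entry-σ⁻¹ (suc k) (s≤s k<n) ⟩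
      posOf (suc (suc k)) σ 1
        ≡⟨ posOf-σ (suc k) (λ e → <-irrefl (sym (suc-injective e)) (s≤s j≤k)) ⟩
      shift (suc i) (posOf (suc (suc k)) (map (shift (suc j)) w) 1)
        ≡⟨ cong (shift (suc i)) (posOf-map _ _ _ unshifted (sgnTimes-shift j) w 1) ⟩
      shift (suc i) (posOf (suc k) w 1)
        ≡⟨ entry-shifted-W k k<n ⟨
      entry (map (shift (suc i)) W) (suc k)
        ≡⟨ entry-ins-> j _ _ k j≤k ⟨
      entry τ (suc (suc k))
        ∎
      where
      unshifted : ∀ x → (∣ shift (suc j) x ∣ ≡ᵇ suc (suc k)) ≡ (∣ x ∣ ≡ᵇ suc k)
      unshifted x = trans (cong (_≡ᵇ suc (suc k)) (∣shift∣ j x))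
                          (shiftℕ-≡ᵇ-above (suc j) ∣ x ∣ (suc k) (s≤s j≤k))

  invB-φ : invB (φ pm (suc i) (suc j) w) ≡ φ pm (suc j) (suc i) (invB w)
  invB-φ = entry-ext (invB σ) τ same-length same-entry
    where
    length-σ⁻¹ : length (invB σ) ≡ suc (length w)
    length-σ⁻¹ = trans (length-invB σ) length-σ
    same-length : length (invB σ) ≡ length τ
    same-length = trans length-σ⁻¹ (sym (trans (length-ins j _ _) (cong suc length-shifted-W)))
    same-entry : ∀ k → k < length (invB σ) → entry (invB σ) (suc k) ≡ entry τ (suc k)
    same-entry k k<n with <-cmp k j
    ... | tri< k<j _ _  = entry-below k k<j
    ... | tri≈ _ refl _ = entry-at
    ... | tri> _ _ j<k  with k | k<n | j<k
    ...   | suc k′ | k′<n | s≤s j≤k′ = entry-above k′ j≤k′ (≤-pred (subst (suc k′ <_) length-σ⁻¹ k′<n))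

-- Vertical paths

entry∈ : ∀ L i → i < length L → entry L (suc i) ∈ L
entry∈ (x ∷ L) zero    _         = here refl
entry∈ (x ∷ L) (suc i) (s≤s i<n) = there (entry∈ L i i<n)

∈⇒entry : ∀ {x} L → x ∈ L → ∃ λ i → i < length L × entry L (suc i) ≡ x
∈⇒entry (y ∷ L) (here refl) = 0 , s≤s z≤n , refl
∈⇒entry (y ∷ L) (there x∈L) with ∈⇒entry L x∈L
... | i , i<n , eq = suc i , s≤s i<n , eq

Unique⇒∣entry∣-injective : ∀ L → Unique (map ∣_∣ L) → ∀ {i i′} → i < length L → i′ < length L →
                           ∣ entry L (suc i) ∣ ≡ ∣ entry L (suc i′) ∣ → i ≡ i′
Unique⇒∣entry∣-injective (x ∷ L) _          {zero}  {zero}   _         _           _  = refl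
Unique⇒∣entry∣-injective (x ∷ L) (x∉ ∷ _)   {zero}  {suc i′} _         (s≤s i′<n) eq =
  contradiction eq (All.lookup x∉ (∈-map⁺ ∣_∣ (entry∈ L i′ i′<n)))
Unique⇒∣entry∣-injective (x ∷ L) (x∉ ∷ _)   {suc i} {zero}   (s≤s i<n) _           eq =
  contradiction (sym eq) (All.lookup x∉ (∈-map⁺ ∣_∣ (entry∈ L i i<n)))
Unique⇒∣entry∣-injective (x ∷ L) (_ ∷ uniq) {suc i} {suc i′} (s≤s i<n) (s≤s i′<n) eq =
  cong suc (Unique⇒∣entry∣-injective L uniq i<n i′<n eq)

∣entry∣-injective⇒AdjacentDistinct : ∀ {n w} → length w ≡ n →
  (∀ {i} → i < n → ∣ entry w (suc i) ∣ ≢ 0) →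
  (∀ {i i′} → i < n → i′ < n → ∣ entry w (suc i) ∣ ≡ ∣ entry w (suc i′) ∣ → i ≡ i′) →
  AdjacentDistinct n w
∣entry∣-injective⇒AdjacentDistinct {n} {w} length≡ nonzero injective =
  record { length≡ = length≡ ; entry≢entry-suc = adjacent }
  where
  adjacent : ∀ i → i < n → entry w i ≢ entry w (suc i)
  adjacent zero    0<n eq = nonzero 0<n (cong ∣_∣ (trans (sym eq) (entry-zero w)))
  adjacent (suc i) i<n eq = contradiction (injective (<-trans (n<1+n i) i<n) i<n (cong ∣_∣ eq)) λ ()

module SignedPermutation {n w} (π : IsSignedPerm n w) where

  length≡ : length w ≡ n
  length≡ = begin
    length w                   ≡⟨ length-map ∣_∣ w ⟨
    length (map ∣_∣ w)         ≡⟨ ↭-length π ⟩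
    length (map suc (upTo n))  ≡⟨ length-map suc (upTo n) ⟩
    length (upTo n)            ≡⟨ length-upTo n ⟩
    n                          ∎

  <n⇒<length : ∀ {i} → i < n → i < length w
  <n⇒<length {i} = subst (i <_) (sym length≡)

  ∣entry∣-range : ∀ {i} → i < n → ∃ λ m → m < n × ∣ entry w (suc i) ∣ ≡ suc m
  ∣entry∣-range {i} i<n with ∈-map⁻ suc (∈-resp-↭ π (∈-map⁺ ∣_∣ (entry∈ w i (<n⇒<length i<n))))
  ... | m , m∈ , eq = m , ∈-upTo⁻ m∈ , eq

  ∣entry∣-onto : ∀ {m} → m < n → ∃ λ i → i < n × ∣ entry w (suc i) ∣ ≡ suc m
  ∣entry∣-onto m<n with ∈-map⁻ ∣_∣ (∈-resp-↭ (↭-sym π) (∈-map⁺ suc (∈-upTo⁺ m<n)))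
  ... | x , x∈w , eq with ∈⇒entry w x∈w
  ...   | i , i<n , refl = i , subst (i <_) length≡ i<n , sym eq

  ∣entry∣-injective : ∀ {i i′} → i < n → i′ < n →
                      ∣ entry w (suc i) ∣ ≡ ∣ entry w (suc i′) ∣ → i ≡ i′
  ∣entry∣-injective i<n i′<n =
    Unique⇒∣entry∣-injective w
      (Unique-resp-↭ (setoid ℕ) (↭⇒↭ₛ (↭-sym π)) (Unique.map⁺ suc-injective (Unique.upTo⁺ n)))
      (<n⇒<length i<n) (<n⇒<length i′<n)

  adjacentDistinct : AdjacentDistinct n w
  adjacentDistinct = ∣entry∣-injective⇒AdjacentDistinct length≡ nonzero ∣entry∣-injective
    where
    nonzero : ∀ {i} → i < n → ∣ entry w (suc i) ∣ ≢ 0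
    nonzero i<n with ∣entry∣-range i<n
    ... | _ , _ , eq = λ e → contradiction (trans (sym eq) e) λ ()

  invB-entry : ∀ {i m} → i < n → ∣ entry w (suc i) ∣ ≡ suc m →
               entry (invB w) (suc m) ≡ sgnTimes (entry w (suc i)) (suc i)
  invB-entry {i} {m} i<n ∣πᵢ∣≡ with posOf-occurrence (suc m) w 1 i (<n⇒<length i<n) ∣πᵢ∣≡
  ... | i′ , i′<n , ∣πᵢ′∣≡ , posOf≡
    with ∣entry∣-injective (subst (i′ <_) length≡ i′<n) i<n (trans ∣πᵢ′∣≡ (sym ∣πᵢ∣≡))
  ...   | refl = trans (entry-invB w m (<n⇒<length m<n)) posOf≡
    where
    m<n : m < n
    m<n with ∣entry∣-range i<n
    ... | m′ , m′<n , ∣πᵢ∣≡′ = subst (_< n) (suc-injective (trans (sym ∣πᵢ∣≡′) ∣πᵢ∣≡)) m′<n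

  invB-adjacentDistinct : AdjacentDistinct n (invB w)
  invB-adjacentDistinct =
    ∣entry∣-injective⇒AdjacentDistinct (trans (length-invB w) length≡) nonzero injective
    where
    position : ∀ {m} → m < n → ∃ λ i → ∣ entry w (suc i) ∣ ≡ suc m × ∣ entry (invB w) (suc m) ∣ ≡ suc i
    position m<n with ∣entry∣-onto m<n
    ... | i , i<n , ∣πᵢ∣≡ =
      i , ∣πᵢ∣≡ , trans (cong ∣_∣ (invB-entry i<n ∣πᵢ∣≡)) (∣sgnTimes∣ (entry w (suc i)) (suc i))
    nonzero : ∀ {m} → m < n → ∣ entry (invB w) (suc m) ∣ ≢ 0
    nonzero m<n with position m<n
    ... | _ , _ , eq = λ e → contradiction (trans (sym eq) e) λ ()
    injective : ∀ {m m′} → m < n → m′ < n →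
                ∣ entry (invB w) (suc m) ∣ ≡ ∣ entry (invB w) (suc m′) ∣ → m ≡ m′
    injective m<n m′<n eq with position m<n | position m′<n
    ... | i , ∣πᵢ∣≡ , ∣σₘ∣≡ | i′ , ∣πᵢ′∣≡ , ∣σₘ′∣≡ =
      suc-injective (trans (sym ∣πᵢ∣≡) (trans (cong (λ k → ∣ entry w k ∣) same-position) ∣πᵢ′∣≡))
      where
      same-position : suc i ≡ suc i′
      same-position = trans (sym ∣σₘ∣≡) (trans eq ∣σₘ′∣≡)

  Sq⇒Sq-invB : ∀ pm {i j} → Sq pm w i j → Sq pm (invB w) j i
  Sq⇒Sq-invB pm {zero}  {j}     sq = contradiction (proj₁ (Sq⇒bounds pm w 0 j sq)) λ ()
  Sq⇒Sq-invB pm {suc i} {suc j} sq@(_ , eq) = s≤s z≤n , (begin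
    entry (invB w) (suc j)                  ≡⟨ invB-entry i<n (trans (cong ∣_∣ eq) (∣val∣ pm (suc j))) ⟩
    sgnTimes (entry w (suc i)) (suc i)      ≡⟨ cong (λ x → sgnTimes x (suc i)) eq ⟩
    sgnTimes (val pm (suc j)) (suc i)       ≡⟨ sgnTimes-val pm j (suc i) ⟩
    val pm (suc i)                          ∎)
    where
    i<n : i < n
    i<n = subst (suc i ≤_) length≡ (proj₂ (Sq⇒bounds pm w (suc i) (suc j) sq))

  Sq-invB⇒Sq : ∀ pm {i j} → Sq pm (invB w) j i → Sq pm w i j
  Sq-invB⇒Sq pm {zero}  {j}     (() , _)
  Sq-invB⇒Sq pm {suc i} {zero}  sq = contradiction (proj₁ (Sq⇒bounds pm (invB w) 0 (suc i) sq)) λ ()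
  Sq-invB⇒Sq pm {suc i} {suc m} sq@(_ , eq) with ∣entry∣-onto m<n
    where
    m<n : m < n
    m<n = subst (suc m ≤_) (trans (length-invB w) length≡)
                (proj₂ (Sq⇒bounds pm (invB w) (suc m) (suc i) sq))
  ... | i′ , i′<n , ∣πᵢ′∣≡
    with sgnTimes≡val pm (entry w (suc i′)) (suc i′) i m ∣πᵢ′∣≡ (trans (sym (invB-entry i′<n ∣πᵢ′∣≡)) eq)
  ...   | πᵢ′≡ , refl = s≤s z≤n , πᵢ′≡

  dtype-vert : ∀ pm {i j} → InGrid n (i , j) → dtype vert pm w i j ≡ dtype horiz pm (invB w) j i
  dtype-vert pm {suc i} {suc j} (_ , s≤s i≤n , _ , s≤s j≤n) =
    cong (λ L → + desB L - + desB (invB w)) (invB-φ pm w (≤-n i≤n) (≤-n j≤n))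
    where
    ≤-n : ∀ {k} → k ≤ n → k ≤ length w
    ≤-n {k} = subst (k ≤_) (sym length≡)

module Transposition {n w} (π : IsSignedPerm n w) (pm : PM) (p : ℕ) where
  open SignedPermutation π
  module V = Paths n w vert pm p
  module H = Paths n (invB w) horiz pm p

  Vtx-swap : ∀ {u} → V.Vtx u → H.Vtx (swap u)
  Vtx-swap (grid@(1≤i , i≤n+1 , 1≤j , j≤n+1) , dtype≡p) =
    (1≤j , j≤n+1 , 1≤i , i≤n+1) , trans (sym (dtype-vert pm grid)) dtype≡p

  Vtx-unswap : ∀ {u} → H.Vtx (swap u) → V.Vtx u
  Vtx-unswap ((1≤j , j≤n+1 , 1≤i , i≤n+1) , dtype≡p) = grid , trans (dtype-vert pm grid) dtype≡p
    where grid = (1≤i , i≤n+1 , 1≤j , j≤n+1)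

  Endpoint-swap : ∀ {u} → V.Endpoint u → H.Endpoint (swap u)
  Endpoint-swap = Sum.map (_∘ Vtx-unswap) (_∘ Vtx-unswap)

  Endpoint-unswap : ∀ {u} → H.Endpoint (swap u) → V.Endpoint u
  Endpoint-unswap = Sum.map (_∘ Vtx-swap) (_∘ Vtx-swap)

  ¬FullLine-swap : ∀ {u} → ¬ V.FullLine u → ¬ H.FullLine (swap u)
  ¬FullLine-swap ¬full full = ¬full λ k 1≤k k≤n+1 → Vtx-unswap (full k 1≤k k≤n+1)

  ¬FullLine-unswap : ∀ {u} → ¬ H.FullLine (swap u) → ¬ V.FullLine u
  ¬FullLine-unswap ¬full full = ¬full λ k 1≤k k≤n+1 → Vtx-swap (full k 1≤k k≤n+1)

  Link-swap : ∀ {u u′} → V.Link u u′ → SymClosure H.Link (swap u) (swap u′)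
  Link-swap (V.line u∈ u′∈) = fwd (H.line (Vtx-swap u∈) (Vtx-swap u′∈))
  Link-swap (V.diag i j sq u∈ u′∈ end end′ ¬full ¬full′) =
    fwd (H.diag j i (Sq⇒Sq-invB pm sq) (Vtx-swap u∈) (Vtx-swap u′∈)
                (Endpoint-swap end) (Endpoint-swap end′)
                (¬FullLine-swap {i , j} ¬full) (¬FullLine-swap {suc i , suc j} ¬full′))
  Link-swap (V.anti i j sq u∈ u′∈ end end′ ¬full ¬full′) =
    bwd (H.anti j i (Sq⇒Sq-invB pm sq) (Vtx-swap u′∈) (Vtx-swap u∈)
                (Endpoint-swap end′) (Endpoint-swap end)
                (¬FullLine-swap {suc i , j} ¬full′) (¬FullLine-swap {i , suc j} ¬full))

  Link-unswap : ∀ {x y} → H.Link x y → SymClosure V.Link (swap x) (swap y)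
  Link-unswap (H.line x∈ y∈) = fwd (V.line (Vtx-unswap x∈) (Vtx-unswap y∈))
  Link-unswap (H.diag i j sq x∈ y∈ end end′ ¬full ¬full′) =
    fwd (V.diag j i (Sq-invB⇒Sq pm sq) (Vtx-unswap x∈) (Vtx-unswap y∈)
                (Endpoint-unswap end) (Endpoint-unswap end′)
                (¬FullLine-unswap {j , i} ¬full) (¬FullLine-unswap {suc j , suc i} ¬full′))
  Link-unswap (H.anti i j sq x∈ y∈ end end′ ¬full ¬full′) =
    bwd (V.anti j i (Sq-invB⇒Sq pm sq) (Vtx-unswap y∈) (Vtx-unswap x∈)
                (Endpoint-unswap end′) (Endpoint-unswap end)
                (¬FullLine-unswap {j , suc i} ¬full′) (¬FullLine-unswap {suc j , i} ¬full))

  SymLink-unswap : ∀ {x y} → SymClosure H.Link x y → SymClosure V.Link (swap x) (swap y)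
  SymLink-unswap (fwd l) = Link-unswap l
  SymLink-unswap (bwd l) = symmetric V.Link (Link-unswap l)

  Conn-swap : ∀ {u u′} → V.Conn u u′ → H.Conn (swap u) (swap u′)
  Conn-swap = gmap swap λ { (fwd l) → Link-swap l ; (bwd l) → symmetric H.Link (Link-swap l) }

  Conn-unswap : ∀ {x y} → H.Conn x y → V.Conn (swap x) (swap y)
  Conn-unswap = gmap swap SymLink-unswap

  StepRule-unswap : ∀ q x y → StepRule horiz q pm (invB w) x y → StepRule vert q pm w (swap x) (swap y)
  StepRule-unswap zero    x y (filled , empty) =
    (λ sq → cong swap (filled (Sq⇒Sq-invB pm sq))) , (λ ¬sq → cong swap (empty (¬sq ∘ Sq-invB⇒Sq pm)))
  StepRule-unswap (suc _) x y (filled , empty) =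
    (λ sq → cong swap (filled (Sq⇒Sq-invB pm sq))) , (λ ¬sq → cong swap (empty (¬sq ∘ Sq-invB⇒Sq pm)))

  verticalPath : p ≤ 1 → ∀ v → V.Vtx v → Σ (ℕ → GP) (V.DescribedPath v)
  verticalPath p≤1 v v∈ with horizontalPaths pm invB-adjacentDistinct p p≤1 (swap v) (Vtx-swap v∈)
  ... | γ , start , end , steps , members = swap ∘ γ , start , end , steps′ , members′
    where
    steps′ : ∀ t → 1 ≤ t → t ≤ n → StepRule vert p pm w (swap (γ t)) (swap (γ (suc t)))
                                   × SymClosure V.Link (swap (γ t)) (swap (γ (suc t)))
    steps′ t 1≤t t≤n with steps t 1≤t t≤n
    ... | rule , link = StepRule-unswap p (γ t) (γ (suc t)) rule , SymLink-unswap link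
    members′ : ∀ u → V.Conn v u ⇔ (Σ ℕ λ t → 1 ≤ t × t ≤ suc n × u ≡ swap (γ t))
    members′ u =
      mk⇔ (λ conn → on-swapped {swap u} {γ} (Equivalence.to (members (swap u)) (Conn-swap conn)))
          (λ on → Conn-unswap (Equivalence.from (members (swap u)) (on-swapped {u} {swap ∘ γ} on)))
      where
      on-swapped : ∀ {x y} → (Σ ℕ λ t → 1 ≤ t × t ≤ suc n × x ≡ y t) →
                   Σ ℕ λ t → 1 ≤ t × t ≤ suc n × swap x ≡ swap (y t)
      on-swapped (t , 1≤t , t≤n+1 , eq) = t , 1≤t , t≤n+1 , cong swap eq

theorem6p6 : PathClaim horiz plus × PathClaim vert plus × PathClaim horiz minus × PathClaim vert minus
theorem6p6 = horizontalClaim plus , verticalClaim plus , horizontalClaim minus , verticalClaim minus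
  where
  horizontalClaim : ∀ pm → PathClaim horiz pm
  horizontalClaim pm n w π = horizontalPaths pm (SignedPermutation.adjacentDistinct π)
  verticalClaim : ∀ pm → PathClaim vert pm
  verticalClaim pm n w π p = Transposition.verticalPath π pm p
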